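{- For every integer $n\geq 0$, $2I^2_n-2^n=I^3_n$.
   Context: Let $X_n=\{1,\dots,n\}$. A preferential arrangement of a finite set is an ordered set partition: a linearly ordered sequence of pairwise disjoint nonempty subsets (blocks) whose union is the set. A restricted barred preferential arrangement of $X_n$ with $m$ bars is a sequence of $m+1$ sections $S_1,\dots,S_{m+1}$, where the $S_i$ are pairwise disjoint, possibly empty, subsets with union $X_n$, such that each of the first $m$ sections $S_1,\dots,S_m$ consists of at most one block (it is either empty or a single block containing all its elements), while the last section $S_{m+1}$ (the free section) carries an arbitrary preferential arrangement of its elements (possibly empty, possibly with several blocks). $I^m_n$ denotes the number of restricted barred preferential arrangements of $X_n$ with $m$ bars. -}

module Defs where

open import Data.Nat using (ℕ; zero; suc; _+_)
open import Data.Fin using (Fin)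
open import Data.Fin.Properties using (all?)
open import Data.Sum using (_⊎_; inj₁; inj₂)
open import Data.List using (List; []; _∷_; [_]; map; concatMap; length; filter; _++_; allFin; upTo)
open import Data.List.Properties using ()
open import Data.Vec using (Vec; []; _∷_)
open import Data.Vec.Membership.Propositional using (_∈_)
open import Data.Vec.Membership.DecPropositional using ()
open import Data.Vec.Relation.Unary.Any using (any?)
open import Data.Sum.Properties using (≡-dec)
open import Data.Fin.Properties using (_≟_)
open import Relation.Nullary using (Dec)
open import Relation.Binary.PropositionalEquality using (_≡_)

allVecs : {A : Set} → List A → (n : ℕ) → List (Vec A n)
allVecs xs zero = [ [] ]
allVecs xs (suc n) = concatMap (λ x → map (x ∷_) (allVecs xs n)) xs

-- A "labelling" of X_n = Fin n: each element is sent either to one of the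
-- m restricted sections (inj₁ s, s : Fin m; the section is a single block or empty)
-- or to block number b (inj₂ b, b : Fin j) of the ordered partition of the
-- free section S_{m+1}.
Label : ℕ → ℕ → Set
Label m j = Fin m ⊎ Fin j

allLabels : (m j : ℕ) → List (Label m j)
allLabels m j = map inj₁ (allFin m) ++ map inj₂ (allFin j)

BlocksNonempty : {m j n : ℕ} → Vec (Label m j) n → Set
BlocksNonempty {m} {j} v = (b : Fin j) → inj₂ b ∈ v

blocksNonempty? : {m j n : ℕ} → (v : Vec (Label m j) n) → Dec (BlocksNonempty v)
blocksNonempty? {m} {j} v = all? (λ b → any? (λ y → ≡-dec _≟_ _≟_ (inj₂ b) y) v)

-- Restricted barred preferential arrangements of X_n with m bars whose free
-- section has exactly j blocks.
RBPA-j : (m n j : ℕ) → List (Vec (Label m j) n)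
RBPA-j m n j = filter blocksNonempty? (allVecs (allLabels m j) n)

sumTo : ℕ → (ℕ → ℕ) → ℕ
sumTo zero f = 0
sumTo (suc k) f = sumTo k f + f k

-- I^m_n: the free section has at most n blocks, so j ranges over 0..n.
I : (m n : ℕ) → ℕ
I m n = sumTo (suc n) (λ j → length (RBPA-j m n j))

module Submission where

-- Read a restricted barred preferential arrangement whose free section has j
-- blocks as a word over the alphabet of the m restricted sections and the j
-- blocks, in which every block letter occurs. Writing covering r k n for the
-- number of words of length n over r free and k required letters that use
-- every required letter, I m n is the sum of covering m j n over j ≤ n. One
-- more free letter is either unused or used, so
-- covering (1 + r) k n = covering r k n + covering r (1 + k) n; summed over k
-- this telescopes to 2 I m n = covering m 0 n + I (1 + m) n, and
-- covering m 0 n = m ^ n.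

open import Defs
open import Data.Nat using (ℕ; zero; suc; _+_; _*_; _^_; _∸_; _<_; pred; s≤s)
open import Data.Nat.Properties using (+-identityʳ; +-assoc; +-comm; +-suc; *-zeroʳ; m≤n⇒m≤1+n; ≤-refl; n∸n≡0; +-commutativeSemigroup)
open import Algebra.Properties.CommutativeSemigroup +-commutativeSemigroup
  using () renaming (interchange to +-interchange; x∙yz≈y∙xz to +-swapˡ)
open import Data.Nat.ListAction using (sum)
open import Data.Nat.ListAction.Properties using (sum-++)
open import Data.Nat.Tactic.RingSolver using (solve-∀)
open import Data.Bool using (true; false)
open import Data.Empty using (⊥-elim)
open import Data.Fin using (Fin; zero; suc; _≟_)
open import Data.Fin.Properties using (all?)
open import Data.Fin.Subset using (Subset; inside; outside; _∈_; _∉_; _-_; ∁; ∣_∣; ⁅_⁆; ⊤)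
open import Data.Fin.Subset.Properties
  using (_∈?_; nonempty?; ∈⊤; ∣⊤∣≡n; ∣⊥∣≡0; ∣∁p∣≡n∸∣p∣; drop-there; p─⊥≡p; p─q⊆p; x∈p∧x≢y⇒x∈p-y; Empty-unique)
open import Data.List using (List; []; _∷_; _++_; map; concatMap; length; filter; tabulate; allFin)
open import Data.List.Properties using (filter-++; length-++; filter-≐; filter-accept; filter-reject; map-cong; map-++; map-tabulate)
open import Data.Product using (_,_)
open import Data.Sum using (inj₁; inj₂)
open import Data.Sum.Properties using (≡-dec; inj₂-injective)
open import Data.Vec using (Vec; []; _∷_; here; there)
open import Data.Vec.Membership.Propositional using () renaming (_∈_ to _∈ᵥ_)
open import Data.Vec.Relation.Unary.Any using (any?; here; there; tail)
open import Data.Vec.Relation.Unary.Any.Properties using (¬Any[])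
open import Function using (_∘_; id)
open import Level using (0ℓ)
open import Relation.Nullary using (Dec; yes; no; does)
open import Relation.Nullary.Decidable using (_→-dec_)
open import Relation.Unary using (Pred; Decidable; _≐_)
open import Relation.Binary.PropositionalEquality
  using (_≡_; refl; sym; trans; cong; cong₂; subst; module ≡-Reasoning)

-- The recurrence reads off the first letter: it is free, or it is one of the
-- k required letters, which is then no longer required.
covering : ℕ → ℕ → ℕ → ℕ
covering r k (suc n) = r * covering r k n + k * covering (suc r) (pred k) n
covering r zero zero = 1
covering r (suc k) zero = 0

covering-zero : ∀ r n → covering r 0 n ≡ r ^ n
covering-zero r zero = refl
covering-zero r (suc n) = trans (+-identityʳ _) (cong (r *_) (covering-zero r n))

covering-vanishes : ∀ r {k n} → n < k → covering r k n ≡ 0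
covering-vanishes r {suc k} {zero} _ = refl
covering-vanishes r {suc k} {suc n} (s≤s n<k) =
  cong₂ _+_ (trans (cong (r *_) (covering-vanishes r (m≤n⇒m≤1+n n<k))) (*-zeroʳ r))
            (trans (cong (suc k *_) (covering-vanishes (suc r) n<k)) (*-zeroʳ (suc k)))

covering-suc-free : ∀ r k n → covering (suc r) k n ≡ covering r k n + covering r (suc k) n
covering-suc-free r zero zero = refl
covering-suc-free r (suc k) zero = refl
covering-suc-free r zero (suc n) = begin
  suc r * covering (suc r) 0 n + 0
    ≡⟨ cong (λ a → suc r * a + 0) (covering-suc-free r 0 n) ⟩
  suc r * (A + B) + 0
    ≡⟨ regroup r A B ⟩
  (r * A + 0) + (r * B + 1 * (A + B))
    ≡⟨ cong (λ a → (r * A + 0) + (r * B + 1 * a)) (covering-suc-free r 0 n) ⟨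
  covering r 0 (suc n) + covering r 1 (suc n)
    ∎
  where
  open ≡-Reasoning
  A = covering r 0 n
  B = covering r 1 n
  regroup : ∀ r a b → suc r * (a + b) + 0 ≡ (r * a + 0) + (r * b + 1 * (a + b))
  regroup = solve-∀
covering-suc-free r (suc k) (suc n) = begin
  suc r * covering (suc r) (suc k) n + suc k * covering (suc (suc r)) k n
    ≡⟨ cong₂ (λ a c → suc r * a + suc k * c) (covering-suc-free r (suc k) n) (covering-suc-free (suc r) k n) ⟩
  suc r * (A + B) + suc k * (C + covering (suc r) (suc k) n)
    ≡⟨ cong (λ a → suc r * (A + B) + suc k * (C + a)) (covering-suc-free r (suc k) n) ⟩
  suc r * (A + B) + suc k * (C + (A + B))
    ≡⟨ regroup r k A B C ⟩
  (r * A + suc k * C) + (r * B + suc (suc k) * (A + B))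
    ≡⟨ cong (λ a → (r * A + suc k * C) + (r * B + suc (suc k) * a)) (covering-suc-free r (suc k) n) ⟨
  covering r (suc k) (suc n) + covering r (suc (suc k)) (suc n)
    ∎
  where
  open ≡-Reasoning
  A = covering r (suc k) n
  B = covering r (suc (suc k)) n
  C = covering (suc r) k n
  regroup : ∀ r k a b c →
    suc r * (a + b) + suc k * (c + (a + b)) ≡ (r * a + suc k * c) + (r * b + suc (suc k) * (a + b))
  regroup = solve-∀

sumTo-cong : ∀ k {f g : ℕ → ℕ} → (∀ j → f j ≡ g j) → sumTo k f ≡ sumTo k g
sumTo-cong zero f≗g = refl
sumTo-cong (suc k) f≗g = cong₂ _+_ (sumTo-cong k f≗g) (f≗g k)

sumTo-+ : ∀ k (f g : ℕ → ℕ) → sumTo k (λ j → f j + g j) ≡ sumTo k f + sumTo k g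
sumTo-+ zero f g = refl
sumTo-+ (suc k) f g = trans (cong (_+ (f k + g k)) (sumTo-+ k f g)) (+-interchange (sumTo k f) (sumTo k g) (f k) (g k))

sumTo-suc : ∀ k (f : ℕ → ℕ) → sumTo (suc k) f ≡ f 0 + sumTo k (f ∘ suc)
sumTo-suc zero f = +-comm 0 (f 0)
sumTo-suc (suc k) f = trans (cong (_+ f (suc k)) (sumTo-suc k f)) (+-assoc (f 0) _ _)

sum-covering-suc-free : ∀ r n →
  2 * sumTo (suc n) (λ j → covering r j n) ≡ r ^ n + sumTo (suc n) (λ j → covering (suc r) j n)
sum-covering-suc-free r n = sym (begin
  r ^ n + sumTo (suc n) (λ j → covering (suc r) j n)
    ≡⟨ cong (r ^ n +_) (trans (sumTo-cong (suc n) (λ j → covering-suc-free r j n)) (sumTo-+ (suc n) _ _)) ⟩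
  r ^ n + (S + T)
    ≡⟨ +-swapˡ (r ^ n) S T ⟩
  S + (r ^ n + T)
    ≡⟨ cong (λ a → S + (a + T)) (covering-zero r n) ⟨
  S + (covering r 0 n + T)
    ≡⟨ cong (S +_) (sumTo-suc (suc n) (λ j → covering r j n)) ⟨
  S + (S + covering r (suc n) n)
    ≡⟨ cong (λ a → S + (S + a)) (covering-vanishes r {n = n} ≤-refl) ⟩
  2 * S
    ∎)
  where
  open ≡-Reasoning
  S = sumTo (suc n) (λ j → covering r j n)
  T = sumTo (suc n) (λ j → covering r (suc j) n)

x∉p⇒p-x≡p : ∀ {n} {x : Fin n} {p : Subset n} → x ∉ p → p - x ≡ p
x∉p⇒p-x≡p {x = zero} {outside ∷ p} _ = cong (outside ∷_) (p─⊥≡p p)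
x∉p⇒p-x≡p {x = zero} {inside ∷ p} x∉p = ⊥-elim (x∉p here)
x∉p⇒p-x≡p {x = suc x} {s ∷ p} x∉p = cong (s ∷_) (x∉p⇒p-x≡p (x∉p ∘ there))

x∉p-x : ∀ {n} {x : Fin n} {p : Subset n} → x ∉ p - x
x∉p-x {x = suc x} {s ∷ p} (there x∈p-x) = x∉p-x x∈p-x

x∈p⇒∣p∣≡suc∣p-x∣ : ∀ {n} {x : Fin n} {p : Subset n} → x ∈ p → ∣ p ∣ ≡ suc ∣ p - x ∣
x∈p⇒∣p∣≡suc∣p-x∣ {x = zero} {inside ∷ p} here = cong (suc ∘ ∣_∣) (sym (p─⊥≡p p))
x∈p⇒∣p∣≡suc∣p-x∣ {x = suc x} {inside ∷ p} (there x∈p) = cong suc (x∈p⇒∣p∣≡suc∣p-x∣ x∈p)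
x∈p⇒∣p∣≡suc∣p-x∣ {x = suc x} {outside ∷ p} (there x∈p) = x∈p⇒∣p∣≡suc∣p-x∣ x∈p

x∈p⇒∣∁[p-x]∣≡suc∣∁p∣ : ∀ {n} {x : Fin n} {p : Subset n} → x ∈ p → ∣ ∁ (p - x) ∣ ≡ suc ∣ ∁ p ∣
x∈p⇒∣∁[p-x]∣≡suc∣∁p∣ {x = zero} {inside ∷ p} here = cong (suc ∘ ∣_∣ ∘ ∁) (p─⊥≡p p)
x∈p⇒∣∁[p-x]∣≡suc∣∁p∣ {x = suc x} {inside ∷ p} (there x∈p) = x∈p⇒∣∁[p-x]∣≡suc∣∁p∣ x∈p
x∈p⇒∣∁[p-x]∣≡suc∣∁p∣ {x = suc x} {outside ∷ p} (there x∈p) = cong suc (x∈p⇒∣∁[p-x]∣≡suc∣∁p∣ x∈p)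

∣∁⊤∣≡0 : ∀ n → ∣ ∁ (⊤ {n}) ∣ ≡ 0
∣∁⊤∣≡0 n = trans (∣∁p∣≡n∸∣p∣ (⊤ {n})) (trans (cong (n ∸_) (∣⊤∣≡n n)) (n∸n≡0 n))

sum-tabulate-const : ∀ k c → sum (tabulate {n = k} (λ _ → c)) ≡ k * c
sum-tabulate-const zero c = refl
sum-tabulate-const (suc k) c = cong (c +_) (sum-tabulate-const k c)

sum-tabulate-∈ : ∀ {n} (p : Subset n) {f : Fin n → ℕ} {X Y : ℕ} →
  (∀ {b} → b ∈ p → f b ≡ X) → (∀ {b} → b ∉ p → f b ≡ Y) →
  sum (tabulate f) ≡ ∣ p ∣ * X + ∣ ∁ p ∣ * Y
sum-tabulate-∈ [] _ _ = refl
sum-tabulate-∈ (inside ∷ p) {X = X} {Y} f∈ f∉ =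
  trans (cong₂ _+_ (f∈ here) (sum-tabulate-∈ p (f∈ ∘ there) (λ b∉p → f∉ (b∉p ∘ drop-there))))
        (sym (+-assoc X _ _))
sum-tabulate-∈ (outside ∷ p) {X = X} {Y} f∈ f∉ =
  trans (cong₂ _+_ (f∉ λ ()) (sum-tabulate-∈ p (f∈ ∘ there) (λ b∉p → f∉ (b∉p ∘ drop-there))))
        (+-swapˡ Y (∣ p ∣ * X) (∣ ∁ p ∣ * Y))

module _ {A : Set} {P : Pred A 0ℓ} (P? : Decidable P) where

  length-filter-concatMap : ∀ {B : Set} (f : B → List A) xs →
    length (filter P? (concatMap f xs)) ≡ sum (map (length ∘ filter P? ∘ f) xs)
  length-filter-concatMap f [] = refl
  length-filter-concatMap f (x ∷ xs) = begin
    length (filter P? (f x ++ concatMap f xs))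
      ≡⟨ cong length (filter-++ P? (f x) _) ⟩
    length (filter P? (f x) ++ filter P? (concatMap f xs))
      ≡⟨ length-++ (filter P? (f x)) ⟩
    length (filter P? (f x)) + length (filter P? (concatMap f xs))
      ≡⟨ cong (length (filter P? (f x)) +_) (length-filter-concatMap f xs) ⟩
    sum (map (length ∘ filter P? ∘ f) (x ∷ xs))
      ∎
    where open ≡-Reasoning

  length-filter-map : ∀ {B : Set} (g : B → A) xs → length (filter P? (map g xs)) ≡ length (filter (P? ∘ g) xs)
  length-filter-map g [] = refl
  length-filter-map g (x ∷ xs) with does (P? (g x))
  ... | true = cong suc (length-filter-map g xs)
  ... | false = length-filter-map g xs

sum-map-allLabels : ∀ {m j} (h : Label m j → ℕ) →
  sum (map h (allLabels m j)) ≡ sum (tabulate (h ∘ inj₁)) + sum (tabulate (h ∘ inj₂))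
sum-map-allLabels {m} {j} h = begin
  sum (map h (map inj₁ (allFin m) ++ map inj₂ (allFin j)))
    ≡⟨ cong sum (map-++ h (map inj₁ (allFin m)) _) ⟩
  sum (map h (map inj₁ (allFin m)) ++ map h (map inj₂ (allFin j)))
    ≡⟨ sum-++ (map h (map inj₁ (allFin m))) _ ⟩
  sum (map h (map inj₁ (allFin m))) + sum (map h (map inj₂ (allFin j)))
    ≡⟨ cong₂ _+_ (cong sum (map-map-allFin inj₁)) (cong sum (map-map-allFin inj₂)) ⟩
  sum (tabulate (h ∘ inj₁)) + sum (tabulate (h ∘ inj₂))
    ∎
  where
  open ≡-Reasoning
  map-map-allFin : ∀ {k} (g : Fin k → Label m j) → map h (map g (allFin k)) ≡ tabulate (h ∘ g)
  map-map-allFin g = trans (cong (map h) (map-tabulate id g)) (map-tabulate g h)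

module Coverage (m j : ℕ) where

  Covers : ∀ {n} → Subset j → Vec (Label m j) n → Set
  Covers p v = ∀ b → b ∈ p → inj₂ b ∈ᵥ v

  covers? : ∀ {n} (p : Subset j) (v : Vec (Label m j) n) → Dec (Covers p v)
  covers? p v = all? λ b → b ∈? p →-dec any? (≡-dec _≟_ _≟_ (inj₂ b)) v

  _∖_ : Subset j → Label m j → Subset j
  p ∖ inj₁ _ = p
  p ∖ inj₂ b = p - b

  covers-∷ : ∀ {n} (p : Subset j) x → (λ (v : Vec (Label m j) n) → Covers p (x ∷ v)) ≐ Covers (p ∖ x)
  covers-∷ p (inj₁ s) = (λ c b b∈p → tail (λ ()) (c b b∈p)) , (λ c b b∈p → there (c b b∈p))
  covers-∷ p (inj₂ b₀) = forward , backward
    where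
    forward : ∀ {n} {v : Vec (Label m j) n} → Covers p (inj₂ b₀ ∷ v) → Covers (p - b₀) v
    forward c b b∈p-b₀ = tail (λ b≡b₀ → x∉p-x (subst (_∈ p - b₀) (inj₂-injective b≡b₀) b∈p-b₀))
                              (c b (p─q⊆p p ⁅ b₀ ⁆ b∈p-b₀))
    backward : ∀ {n} {v : Vec (Label m j) n} → Covers (p - b₀) v → Covers p (inj₂ b₀ ∷ v)
    backward c b b∈p with b ≟ b₀
    ... | yes refl = here refl
    ... | no b≢b₀ = there (c b (x∈p∧x≢y⇒x∈p-y b∈p b≢b₀))

  coverCount : Subset j → ℕ → ℕ
  coverCount p n = length (filter (covers? p) (allVecs (allLabels m j) n))

  coverCount-zero : ∀ p → coverCount p 0 ≡ covering (m + ∣ ∁ p ∣) ∣ p ∣ 0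
  coverCount-zero p with nonempty? p
  ... | yes (b , b∈p) =
    trans (cong length (filter-reject (covers? p) λ c → ¬Any[] (c b b∈p)))
          (sym (cong (λ k → covering (m + ∣ ∁ p ∣) k 0) (x∈p⇒∣p∣≡suc∣p-x∣ b∈p)))
  ... | no p-empty =
    trans (cong length (filter-accept (covers? p) λ b b∈p → ⊥-elim (p-empty (b , b∈p))))
          (sym (cong (λ k → covering (m + ∣ ∁ p ∣) k 0) (trans (cong ∣_∣ (Empty-unique p-empty)) (∣⊥∣≡0 j))))

  coverCount-suc : ∀ p n → coverCount p (suc n) ≡ m * coverCount p n + sum (tabulate λ b → coverCount (p - b) n)
  coverCount-suc p n = begin
    length (filter (covers? p) (concatMap (λ x → map (x ∷_) words) (allLabels m j)))
      ≡⟨ length-filter-concatMap (covers? p) _ (allLabels m j) ⟩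
    sum (map (λ x → length (filter (covers? p) (map (x ∷_) words))) (allLabels m j))
      ≡⟨ cong sum (map-cong firstLetter (allLabels m j)) ⟩
    sum (map (λ x → coverCount (p ∖ x) n) (allLabels m j))
      ≡⟨ sum-map-allLabels (λ x → coverCount (p ∖ x) n) ⟩
    sum (tabulate {n = m} λ _ → coverCount p n) + sum (tabulate λ b → coverCount (p - b) n)
      ≡⟨ cong (_+ sum (tabulate λ b → coverCount (p - b) n)) (sum-tabulate-const m (coverCount p n)) ⟩
    m * coverCount p n + sum (tabulate λ b → coverCount (p - b) n)
      ∎
    where
    open ≡-Reasoning
    words = allVecs (allLabels m j) n
    firstLetter : ∀ x → length (filter (covers? p) (map (x ∷_) words)) ≡ coverCount (p ∖ x) n
    firstLetter x = trans (length-filter-map (covers? p) (x ∷_) words)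
                          (cong length (filter-≐ (covers? p ∘ (x ∷_)) (covers? (p ∖ x)) (covers-∷ p x) words))

  -- The letters outside p, namely the m restricted sections and the blocks
  -- already known to be filled, are the free letters.
  coverCount≡covering : ∀ n p → coverCount p n ≡ covering (m + ∣ ∁ p ∣) ∣ p ∣ n
  coverCount≡covering zero p = coverCount-zero p
  coverCount≡covering (suc n) p = begin
    coverCount p (suc n)
      ≡⟨ coverCount-suc p n ⟩
    m * coverCount p n + sum (tabulate λ b → coverCount (p - b) n)
      ≡⟨ cong₂ (λ a c → m * a + c) (coverCount≡covering n p) (sum-tabulate-∈ p removeMember removeNonMember) ⟩
    m * Y + (∣ p ∣ * X + ∣ ∁ p ∣ * Y)
      ≡⟨ regroup m (∣ ∁ p ∣) (∣ p ∣) X Y ⟩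
    (m + ∣ ∁ p ∣) * Y + ∣ p ∣ * X
      ≡⟨ cong (λ r → (m + ∣ ∁ p ∣) * Y + ∣ p ∣ * covering r (pred ∣ p ∣) n) (+-suc m ∣ ∁ p ∣) ⟩
    covering (m + ∣ ∁ p ∣) ∣ p ∣ (suc n)
      ∎
    where
    open ≡-Reasoning
    X = covering (m + suc ∣ ∁ p ∣) (pred ∣ p ∣) n
    Y = covering (m + ∣ ∁ p ∣) ∣ p ∣ n
    removeMember : ∀ {b} → b ∈ p → coverCount (p - b) n ≡ X
    removeMember b∈p = trans (coverCount≡covering n (p - _))
      (cong₂ (λ c k → covering (m + c) k n) (x∈p⇒∣∁[p-x]∣≡suc∣∁p∣ b∈p) (cong pred (sym (x∈p⇒∣p∣≡suc∣p-x∣ b∈p))))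
    removeNonMember : ∀ {b} → b ∉ p → coverCount (p - b) n ≡ Y
    removeNonMember b∉p = trans (cong (λ q → coverCount q n) (x∉p⇒p-x≡p b∉p)) (coverCount≡covering n p)
    regroup : ∀ m c k x y → m * y + (k * x + c * y) ≡ (m + c) * y + k * x
    regroup = solve-∀

  length-RBPA-j : ∀ n → length (RBPA-j m n j) ≡ covering m j n
  length-RBPA-j n = begin
    length (filter blocksNonempty? (allVecs (allLabels m j) n))
      ≡⟨ cong length (filter-≐ blocksNonempty? (covers? ⊤) ((λ c b _ → c b) , (λ c b → c b ∈⊤)) (allVecs (allLabels m j) n)) ⟩
    coverCount ⊤ n
      ≡⟨ coverCount≡covering n ⊤ ⟩
    covering (m + ∣ ∁ (⊤ {j}) ∣) ∣ ⊤ {j} ∣ n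
      ≡⟨ cong₂ (λ c k → covering (m + c) k n) (∣∁⊤∣≡0 j) (∣⊤∣≡n j) ⟩
    covering (m + 0) j n
      ≡⟨ cong (λ r → covering r j n) (+-identityʳ m) ⟩
    covering m j n
      ∎
    where open ≡-Reasoning

I≡sum-covering : ∀ m n → I m n ≡ sumTo (suc n) (λ j → covering m j n)
I≡sum-covering m n = sumTo-cong (suc n) (λ j → Coverage.length-RBPA-j m j n)

2*I≡m^n+I-suc : ∀ m n → 2 * I m n ≡ m ^ n + I (suc m) n
2*I≡m^n+I-suc m n = begin
  2 * I m n
    ≡⟨ cong (2 *_) (I≡sum-covering m n) ⟩
  2 * sumTo (suc n) (λ j → covering m j n)
    ≡⟨ sum-covering-suc-free m n ⟩
  m ^ n + sumTo (suc n) (λ j → covering (suc m) j n)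
    ≡⟨ cong (m ^ n +_) (I≡sum-covering (suc m) n) ⟨
  m ^ n + I (suc m) n
    ∎
  where open ≡-Reasoning

lemma4 : (n : ℕ) → 2 * I 2 n ≡ 2 ^ n + I 3 n
lemma4 = 2*I≡m^n+I-suc 2
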